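{- Let $G$ be a finite graph, $M$ a module of $G$, and $S$ an independent set of $G$ with $|S\cap M|\le 1$. Then every independent set $S'$ of $G$ with $S\leftrightsquigarrow S'$ satisfies $|S'\cap M|\le 1$.
   Context: Token Sliding ($\mathsf{TS}$): for independent sets $S,S'$ of a graph $G$ with $|S|=|S'|$, write $S\leftrightarrow S'$ if $|S\triangle S'|=2$ and the two vertices of $S\triangle S'$ are adjacent in $G$. Write $S\leftrightsquigarrow S'$ if there exist $\ell\ge 0$ and independent sets $S_0=S,\dots,S_\ell=S'$ of $G$ with $S_{i-1}\leftrightarrow S_i$ for all $i$. A module of $G=(V,E)$ is a set $M\subseteq V$ such that every vertex of $V\setminus M$ is adjacent to all or to none of the vertices of $M$. -}

module Defs where

open import Data.Nat using (ℕ; _≤_)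
open import Data.Fin using (Fin)
open import Data.Fin.Subset using (Subset; _∈_; _∉_; _∩_; _∪_; _─_; ∣_∣)
open import Data.Product using (_×_; Σ)
open import Data.Sum using (_⊎_)
open import Relation.Nullary using (¬_)
open import Relation.Binary.PropositionalEquality using (_≡_)
open import Relation.Binary.Construct.Closure.ReflexiveTransitive using (Star)
open import Level using (0ℓ)

record Graph (n : ℕ) : Set₁ where
  field
    Adj     : Fin n → Fin n → Set
    irrefl  : ∀ {x} → ¬ Adj x x
    sym     : ∀ {x y} → Adj x y → Adj y x
open Graph public

module _ {n : ℕ} (G : Graph n) where

  Independent : Subset n → Set
  Independent S = ∀ {x y} → x ∈ S → y ∈ S → ¬ Adj G x y

  IsModule : Subset n → Set
  IsModule M = ∀ v → v ∉ M →
    ((∀ u → u ∈ M → Adj G v u) ⊎ (∀ u → u ∈ M → ¬ Adj G v u))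

_△_ : ∀ {n} → Subset n → Subset n → Subset n
S △ T = (S ─ T) ∪ (T ─ S)

module _ {n : ℕ} (G : Graph n) where

  TSStep : Subset n → Subset n → Set
  TSStep S S' =
    Independent G S × Independent G S' × (∣ S ∣ ≡ ∣ S' ∣) ×
    (∣ S △ S' ∣ ≡ 2) ×
    (∀ x y → x ∈ S △ S' → y ∈ S △ S' → ¬ (x ≡ y) → Adj G x y)

  TSReach : Subset n → Subset n → Set
  TSReach = Star TSStep

module Submission where

-- A subset p has at most one element iff any two of its members coincide
-- (`≤1⇒members-equal`, `members-equal⇒≤1`), so it suffices to show that
-- every single sliding step S ↔ S' maps "any two tokens in M coincide" for S
-- to the same property for S'; the corollary then follows by induction on
-- the sliding sequence.  For one step with |S ∩ M| ≤ 1, take a, b ∈ S' ∩ M: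
--   * a, b ∈ S: they coincide since |S ∩ M| ≤ 1;
--   * a, b ∉ S: both entered in this step, so they are adjacent unless equal,
--     and S' is independent (`entering-unique`);
--   * a ∉ S, b ∈ S: as |S| = |S'| some token x ∈ S leaves (`some-token-leaves`)
--     and x is adjacent to a (`leaving-adjacent-entering`).  If x ∈ M then
--     x = b, contradicting b ∈ S'; if x ∉ M then x sees none of M, because it
--     is not adjacent to b ∈ S (`independent-module-split`), yet it sees a ∈ M.

open import Defs hiding (sym)
open import Data.Nat using (ℕ; _≤_; _<_; z≤n)
open import Data.Nat.Properties using (<-irrefl; <-≤-trans; <⇒≢)
open import Data.Fin using (Fin; _≟_)
open import Data.Fin.Subset using (Subset; _∈_; _∉_; _⊆_; _∩_; ⁅_⁆; ∣_∣)
open import Data.Fin.Subset.Properties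
  using ( _∈?_; x∈p∩q⁺; x∈p∩q⁻; x∈p∪q⁺; x∈p∧x∉q⇒x∈p─q; x∈⁅x⁆; x∈⁅y⁆⇒x≡y; ∣⁅x⁆∣≡1
        ; ∣⊥∣≡0; p⊆q⇒∣p∣≤∣q∣; p⊂q⇒∣p∣<∣q∣; nonempty?; Empty-unique )
open import Data.Fin.Properties using (any?)
open import Data.Product using (_×_; _,_; ∃; proj₁; proj₂)
open import Data.Sum using (inj₁; inj₂)
open import Data.Empty using (⊥-elim)
open import Relation.Nullary using (¬_; yes; no; contradiction)
open import Relation.Nullary.Decidable using (_×-dec_; ¬?)
open import Relation.Binary.PropositionalEquality using (_≡_; refl; sym; subst)
open import Relation.Binary.Construct.Closure.ReflexiveTransitive using (ε; _◅_)

MembersEqual : ∀ {n} → Subset n → Set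
MembersEqual p = ∀ {a b} → a ∈ p → b ∈ p → a ≡ b

-- Two distinct members would make ⁅ a ⁆ a proper subset of p, so ∣ p ∣ > 1.
≤1⇒members-equal : ∀ {n} {p : Subset n} → ∣ p ∣ ≤ 1 → MembersEqual p
≤1⇒members-equal {p = p} ∣p∣≤1 {a} {b} a∈p b∈p with a ≟ b
... | yes a≡b = a≡b
... | no a≢b = ⊥-elim (<-irrefl refl (<-≤-trans 1<∣p∣ ∣p∣≤1))
  where
  ⁅a⁆⊆p : ⁅ a ⁆ ⊆ p
  ⁅a⁆⊆p x∈⁅a⁆ = subst (_∈ p) (sym (x∈⁅y⁆⇒x≡y a x∈⁅a⁆)) a∈p

  b∉⁅a⁆ : b ∉ ⁅ a ⁆
  b∉⁅a⁆ b∈⁅a⁆ = a≢b (sym (x∈⁅y⁆⇒x≡y a b∈⁅a⁆))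

  1<∣p∣ : 1 < ∣ p ∣
  1<∣p∣ = subst (_< ∣ p ∣) (∣⁅x⁆∣≡1 a) (p⊂q⇒∣p∣<∣q∣ (⁅a⁆⊆p , b , b∈p , b∉⁅a⁆))

-- Conversely, p is empty or contained in the singleton of any of its members.
members-equal⇒≤1 : ∀ {n} {p : Subset n} → MembersEqual p → ∣ p ∣ ≤ 1
members-equal⇒≤1 {n} {p} equal with nonempty? p
... | no empty = subst (λ q → ∣ q ∣ ≤ 1) (sym (Empty-unique empty))
                   (subst (_≤ 1) (sym (∣⊥∣≡0 n)) z≤n)
... | yes (a , a∈p) = subst (∣ p ∣ ≤_) (∣⁅x⁆∣≡1 a) (p⊆q⇒∣p∣≤∣q∣ p⊆⁅a⁆)
  where
  p⊆⁅a⁆ : p ⊆ ⁅ a ⁆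
  p⊆⁅a⁆ x∈p = subst (_∈ ⁅ a ⁆) (equal a∈p x∈p) (x∈⁅x⁆ a)

-- Between two sets of equal size, if some element enters then some other
-- element must leave (otherwise S ⊂ S' would force ∣ S ∣ < ∣ S' ∣).
some-token-leaves : ∀ {n} {a : Fin n} (S S' : Subset n) → ∣ S ∣ ≡ ∣ S' ∣ →
                    a ∈ S' → a ∉ S → ∃ λ x → x ∈ S × x ∉ S'
some-token-leaves {a = a} S S' ∣S∣≡∣S'∣ a∈S' a∉S
  with any? (λ x → (x ∈? S) ×-dec ¬? (x ∈? S'))
... | yes leaving = leaving
... | no none-leaves = contradiction ∣S∣≡∣S'∣ (<⇒≢ (p⊂q⇒∣p∣<∣q∣ (S⊆S' , a , a∈S' , a∉S)))
  where
  S⊆S' : S ⊆ S'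
  S⊆S' {x} x∈S with x ∈? S'
  ... | yes x∈S' = x∈S'
  ... | no x∉S' = ⊥-elim (none-leaves (x , x∈S , x∉S'))

-- A vertex x ∉ M lying in an independent set together with some b ∈ M is not
-- adjacent to b, so by the module property it is adjacent to no vertex of M.
independent-module-split : ∀ {n} (G : Graph n) {M S : Subset n} {x b : Fin n} →
  IsModule G M → Independent G S → x ∈ S → x ∉ M → b ∈ S → b ∈ M →
  ∀ u → u ∈ M → ¬ Adj G x u
independent-module-split G module-M indep-S x∈S x∉M b∈S b∈M with module-M _ x∉M
... | inj₁ sees-all = ⊥-elim (indep-S x∈S b∈S (sees-all _ b∈M))
... | inj₂ sees-none = sees-none

module SlidingStep {n : ℕ} (G : Graph n) {S S' : Subset n} (step : TSStep G S S') where

  private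
    adjacent-in-△ : ∀ x y → x ∈ S △ S' → y ∈ S △ S' → ¬ x ≡ y → Adj G x y
    adjacent-in-△ = proj₂ (proj₂ (proj₂ (proj₂ step)))

    entering∈△ : ∀ {x} → x ∈ S' → x ∉ S → x ∈ S △ S'
    entering∈△ x∈S' x∉S = x∈p∪q⁺ (inj₂ (x∈p∧x∉q⇒x∈p─q x∈S' x∉S))

    leaving∈△ : ∀ {x} → x ∈ S → x ∉ S' → x ∈ S △ S'
    leaving∈△ x∈S x∉S' = x∈p∪q⁺ (inj₁ (x∈p∧x∉q⇒x∈p─q x∈S x∉S'))

  independent-before : Independent G S
  independent-before = proj₁ step

  independent-after : Independent G S'
  independent-after = proj₁ (proj₂ step)

  same-size : ∣ S ∣ ≡ ∣ S' ∣
  same-size = proj₁ (proj₂ (proj₂ step))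

  -- Any two entering tokens would be adjacent in the independent set S'.
  entering-unique : ∀ {a b} → a ∈ S' → a ∉ S → b ∈ S' → b ∉ S → a ≡ b
  entering-unique {a} {b} a∈S' a∉S b∈S' b∉S with a ≟ b
  ... | yes a≡b = a≡b
  ... | no a≢b = ⊥-elim (independent-after a∈S' b∈S'
                   (adjacent-in-△ a b (entering∈△ a∈S' a∉S) (entering∈△ b∈S' b∉S) a≢b))

  leaving-adjacent-entering : ∀ {x a} → x ∈ S → x ∉ S' → a ∈ S' → a ∉ S → Adj G x a
  leaving-adjacent-entering {x} {a} x∈S x∉S' a∈S' a∉S =
    adjacent-in-△ x a (leaving∈△ x∈S x∉S') (entering∈△ a∈S' a∉S)
      (λ x≡a → a∉S (subst (_∈ S) x≡a x∈S))

step-preserves : ∀ {n} (G : Graph n) {M S S' : Subset n} → IsModule G M →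
                 TSStep G S S' → ∣ S ∩ M ∣ ≤ 1 → ∣ S' ∩ M ∣ ≤ 1
step-preserves G {M} {S} {S'} module-M step ∣S∩M∣≤1 =
  members-equal⇒≤1 λ a∈ b∈ → two-tokens-equal (x∈p∩q⁻ S' M a∈) (x∈p∩q⁻ S' M b∈)
  where
  open SlidingStep G step

  old-tokens-equal : MembersEqual (S ∩ M)
  old-tokens-equal = ≤1⇒members-equal ∣S∩M∣≤1

  no-entry-beside : ∀ {a b} → a ∈ S' × a ∈ M → a ∉ S → b ∈ S' × b ∈ M → b ∈ S → a ≡ b
  no-entry-beside (a∈S' , a∈M) a∉S (b∈S' , b∈M) b∈S
    with some-token-leaves S S' same-size a∈S' a∉S
  ... | x , x∈S , x∉S' with x ∈? M
  ...   | yes x∈M = contradiction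
          (subst (_∈ S') (sym (old-tokens-equal (x∈p∩q⁺ (x∈S , x∈M)) (x∈p∩q⁺ (b∈S , b∈M)))) b∈S')
          x∉S'
  ...   | no x∉M = ⊥-elim (independent-module-split G module-M independent-before x∈S x∉M b∈S b∈M
                            _ a∈M (leaving-adjacent-entering x∈S x∉S' a∈S' a∉S))

  two-tokens-equal : ∀ {a b} → a ∈ S' × a ∈ M → b ∈ S' × b ∈ M → a ≡ b
  two-tokens-equal {a} {b} (a∈S' , a∈M) (b∈S' , b∈M) with a ∈? S | b ∈? S
  ... | yes a∈S | yes b∈S = old-tokens-equal (x∈p∩q⁺ (a∈S , a∈M)) (x∈p∩q⁺ (b∈S , b∈M))
  ... | no a∉S  | yes b∈S = no-entry-beside (a∈S' , a∈M) a∉S (b∈S' , b∈M) b∈S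
  ... | yes a∈S | no b∉S  = sym (no-entry-beside (b∈S' , b∈M) b∉S (a∈S' , a∈M) a∈S)
  ... | no a∉S  | no b∉S  = entering-unique a∈S' a∉S b∈S' b∉S

reach-preserves : ∀ {n} (G : Graph n) {M S S' : Subset n} → IsModule G M →
                  TSReach G S S' → ∣ S ∩ M ∣ ≤ 1 → ∣ S' ∩ M ∣ ≤ 1
reach-preserves G module-M ε              ∣S∩M∣≤1 = ∣S∩M∣≤1
reach-preserves G module-M (step ◅ steps) ∣S∩M∣≤1 =
  reach-preserves G module-M steps (step-preserves G module-M step ∣S∩M∣≤1)

-- The independence hypotheses are implied by the sliding sequence itself.
corollary2 : ∀ {n : ℕ} (G : Graph n) (M S S' : Subset n) →
    IsModule G M → Independent G S → ∣ S ∩ M ∣ ≤ 1 →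
    Independent G S' → TSReach G S S' → ∣ S' ∩ M ∣ ≤ 1
corollary2 G M S S' module-M _ ∣S∩M∣≤1 _ steps = reach-preserves G module-M steps ∣S∩M∣≤1
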